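{- If $\mathcal{D}$ is a $\mathbf{PETS}(\mathrm{Ax})$ derivation with $\mathcal{D}\vdash t=u$, then there exists a derivation $\mathcal{D}'$ in Variable Normal Form such that $\mathcal{D}'\vdash t=u$ and $\mathrm{lh}(\mathcal{D}')=O(\mathrm{lh}(\mathcal{D})^2)$.
   Context: Terms are built from variables and function symbols $f\in\mathcal{F}$ (with arities), where $\mathcal{F}$ contains the basic symbols $\epsilon,\mathrm{s}_0,\mathrm{s}_1$ (forming $\mathcal{B}$). $\mathrm{Ax}$ is a set of nice axioms: each equation has the form $f(\vec x)=t$, $f(\epsilon,\vec x)=t_\epsilon$, $f(x0,\vec x)=t_0$ or $f(x1,\vec x)=t_1$ for some $f\in\mathcal{F}\setminus\mathcal{B}$ (with the right-hand side only using the variables of the left-hand side), and each left-hand side occurs at most once in $\mathrm{Ax}$, also modulo substitution. A generalized variable is a variable, $\epsilon$, or $\mathrm{s}_i(x)$ for a variable $x$. $\mathbf{PETS}(\mathrm{Ax})$ derivations use the rules: Axiom ($\vdash t=u$ for any substitution instance of an equation of $\mathrm{Ax}$), Reflexivity, Symmetry, Transitivity, Compatibility ($t=u\vdash s[t/x]=s[u/x]$) and Substitution ($t=u\vdash t[s/x]=u[s/x]$, which binds $x$). The length $\mathrm{lh}(\mathcal{D})$ of a derivation is the sum of lengths (number of symbols) of its equations plus the syntax identifying rule applications. An instance of an equation $s=t$ of $\mathrm{Ax}$ is an injective renaming if it replaces exactly the variables of $s,t$ by pairwise distinct variables. A derivation is in Variable Normal Form if (1) Axiom rules only occur with equations that are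 injective renamings of equations in $\mathrm{Ax}$ (so the left-hand side is $f(\vec t)$ with each $t_i$ a generalized variable and no variable shared between different $t_i$, $t_j$), and (2) each variable occurring in the derivation either occurs in the final equation or is removed in exactly one application of Substitution (as the variable bound by it). -}

module Defs where

open import Data.Nat using (ℕ; zero; suc; _+_; _*_; _≡ᵇ_)
open import Data.Bool using (Bool; true; false; _∨_; _∧_; not; if_then_else_)
open import Data.Vec using (Vec; []; _∷_)
open import Data.List using (List; []; _∷_; _++_)
open import Data.List.Membership.Propositional using (_∈_)
open import Data.List.Relation.Unary.Unique.Propositional using (Unique)
open import Data.Product using (Σ; ∃; _×_; _,_)
open import Data.Sum using (_⊎_)
open import Data.Unit using (⊤)
open import Relation.Binary.PropositionalEquality using (_≡_)

-- Signatures.  The basic symbols ε, s₀, s₁ (the set 𝓑) are built into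
-- the term syntax; 'Fun' is the set 𝓕 ∖ 𝓑 of the other function
-- symbols, each with an arity.

record Signature : Set₁ where
  field
    Fun   : Set
    arity : Fun → ℕ
open Signature public

data Term (S : Signature) : Set where
  var : ℕ → Term S
  eps : Term S
  s0  : Term S → Term S
  s1  : Term S → Term S
  app : (f : Fun S) → Vec (Term S) (arity S f) → Term S

module _ {S : Signature} where

  mutual
    size : Term S → ℕ
    size (var x)    = 1
    size eps        = 1
    size (s0 t)     = suc (size t)
    size (s1 t)     = suc (size t)
    size (app f ts) = suc (sizes ts)

    sizes : ∀ {n} → Vec (Term S) n → ℕ
    sizes []       = 0
    sizes (t ∷ ts) = size t + sizes ts

  mutual
    vars : Term S → List ℕ
    vars (var x)    = x ∷ []
    vars eps        = []
    vars (s0 t)     = vars t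
    vars (s1 t)     = vars t
    vars (app f ts) = varss ts

    varss : ∀ {n} → Vec (Term S) n → List ℕ
    varss []       = []
    varss (t ∷ ts) = vars t ++ varss ts

  mutual
    occ : ℕ → Term S → Bool
    occ x (var y)    = x ≡ᵇ y
    occ x eps        = false
    occ x (s0 t)     = occ x t
    occ x (s1 t)     = occ x t
    occ x (app f ts) = occs x ts

    occs : ∀ {n} → ℕ → Vec (Term S) n → Bool
    occs x []       = false
    occs x (t ∷ ts) = occ x t ∨ occs x ts

  mutual
    sub : (ℕ → Term S) → Term S → Term S
    sub σ (var x)    = σ x
    sub σ eps        = eps
    sub σ (s0 t)     = s0 (sub σ t)
    sub σ (s1 t)     = s1 (sub σ t)
    sub σ (app f ts) = app f (subs σ ts)

    subs : ∀ {n} → (ℕ → Term S) → Vec (Term S) n → Vec (Term S) n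
    subs σ []       = []
    subs σ (t ∷ ts) = sub σ t ∷ subs σ ts

  infix 30 _[_/_]
  _[_/_] : Term S → Term S → ℕ → Term S
  s [ t / x ] = sub (λ y → if x ≡ᵇ y then t else var y) s

  Eqn : Set
  Eqn = Term S × Term S

  lhsOf : Eqn → Term S
  lhsOf (l , r) = l

  rhsOf : Eqn → Term S
  rhsOf (l , r) = r

  IsVar : Term S → Set
  IsVar t = Σ ℕ λ x → t ≡ var x

  data GenVar : Term S → Set where
    gv-var : ∀ x → GenVar (var x)
    gv-eps : GenVar eps
    gv-s0  : ∀ x → GenVar (s0 (var x))
    gv-s1  : ∀ x → GenVar (s1 (var x))

  data AllVars : ∀ {n} → Vec (Term S) n → Set where
    []  : AllVars []
    _∷_ : ∀ {n t} {ts : Vec (Term S) n} → IsVar t → AllVars ts → AllVars (t ∷ ts)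

  -- argument list of a nice left-hand side:
  --   f(x⃗)  or  f(ε,x⃗), f(x0,x⃗), f(x1,x⃗)
  -- (covered by: empty, or first argument a generalized variable and the
  --  rest variables), all variables pairwise distinct.
  data NiceArgs : ∀ {n} → Vec (Term S) n → Set where
    nil  : NiceArgs []
    cons : ∀ {n t} {ts : Vec (Term S) n} → GenVar t → AllVars ts → NiceArgs (t ∷ ts)

  NiceEqn : Eqn → Set
  NiceEqn (l , r) =
    Σ (Fun S) λ f → Σ (Vec (Term S) (arity S f)) λ ts →
      (l ≡ app f ts) × NiceArgs ts × Unique (varss ts)
      × (∀ {x} → x ∈ vars r → x ∈ varss ts)

  Nice : (Eqn → Set) → Set
  Nice Ax =
    (∀ e → Ax e → NiceEqn e)
    × (∀ e₁ e₂ → Ax e₁ → Ax e₂ → (σ : ℕ → Term S) →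
         lhsOf e₂ ≡ sub σ (lhsOf e₁) → e₁ ≡ e₂)

  infix 4 _⊢_≈_
  data _⊢_≈_ (Ax : Eqn → Set) : Term S → Term S → Set where
    axiom  : (e : Eqn) → Ax e → (σ : ℕ → Term S) →
             Ax ⊢ sub σ (lhsOf e) ≈ sub σ (rhsOf e)
    reflR  : (t : Term S) → Ax ⊢ t ≈ t
    symR   : ∀ {t u} → Ax ⊢ t ≈ u → Ax ⊢ u ≈ t
    transR : ∀ {t u v} → Ax ⊢ t ≈ u → Ax ⊢ u ≈ v → Ax ⊢ t ≈ v
    compat : ∀ {t u} (s : Term S) (x : ℕ) → Ax ⊢ t ≈ u →
             Ax ⊢ s [ t / x ] ≈ s [ u / x ]
    substR : ∀ {t u} (x : ℕ) (s : Term S) → Ax ⊢ t ≈ u →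
             Ax ⊢ t [ s / x ] ≈ u [ s / x ]

  module _ {Ax : Eqn → Set} where

    -- length of a derivation: sum of the lengths of all its equations
    -- (|t| + |u| + 1 for the '=' sign) plus the syntax identifying each
    -- rule application (one symbol for the rule name, and for
    -- Compatibility / Substitution additionally the term s and the variable x)
    lh : ∀ {t u} → Ax ⊢ t ≈ u → ℕ
    lh {t} {u} (axiom e a σ)  = size t + size u + 1 + 1
    lh {t} {u} (reflR _)      = size t + size u + 1 + 1
    lh {t} {u} (symR d)       = size t + size u + 1 + 1 + lh d
    lh {t} {u} (transR d d′)  = size t + size u + 1 + 1 + lh d + lh d′
    lh {t} {u} (compat s x d) = size t + size u + 1 + (1 + size s + 1) + lh d
    lh {t} {u} (substR x s d) = size t + size u + 1 + (1 + size s + 1) + lh d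

    occD : ∀ {t u} → ℕ → Ax ⊢ t ≈ u → Bool
    occD {t} {u} v (axiom e a σ)  = occ v t ∨ occ v u
    occD {t} {u} v (reflR _)      = occ v t ∨ occ v u
    occD {t} {u} v (symR d)       = occ v t ∨ occ v u ∨ occD v d
    occD {t} {u} v (transR d d′)  = occ v t ∨ occ v u ∨ occD v d ∨ occD v d′
    occD {t} {u} v (compat s x d) = occ v t ∨ occ v u ∨ occD v d
    occD {t} {u} v (substR x s d) = occ v t ∨ occ v u ∨ occD v d

    -- number of applications of Substitution that remove the variable v:
    -- v is the bound variable, v occurs in the premise, and v does not
    -- occur in the substituted term s (so v is gone from the conclusion)
    removals : ∀ {t u} → ℕ → Ax ⊢ t ≈ u → ℕ
    removals v (axiom e a σ)  = 0
    removals v (reflR _)      = 0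
    removals v (symR d)       = removals v d
    removals v (transR d d′)  = removals v d + removals v d′
    removals v (compat s x d) = removals v d
    removals v (substR {t} {u} x s d) =
      (if (x ≡ᵇ v) ∧ (occ v t ∨ occ v u) ∧ not (occ v s) then 1 else 0)
      + removals v d

    InjRenaming : Eqn → (ℕ → Term S) → Set
    InjRenaming e σ =
      (∀ {x} → x ∈ vars (lhsOf e) ++ vars (rhsOf e) → IsVar (σ x))
      × (∀ {x y} → x ∈ vars (lhsOf e) ++ vars (rhsOf e) →
                   y ∈ vars (lhsOf e) ++ vars (rhsOf e) →
                   σ x ≡ σ y → x ≡ y)

    AxiomsRenamed : ∀ {t u} → Ax ⊢ t ≈ u → Set
    AxiomsRenamed (axiom e a σ)  = InjRenaming e σ
    AxiomsRenamed (reflR _)      = ⊤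
    AxiomsRenamed (symR d)       = AxiomsRenamed d
    AxiomsRenamed (transR d d′)  = AxiomsRenamed d × AxiomsRenamed d′
    AxiomsRenamed (compat s x d) = AxiomsRenamed d
    AxiomsRenamed (substR x s d) = AxiomsRenamed d

    VNF : ∀ {t u} → Ax ⊢ t ≈ u → Set
    VNF {t} {u} d =
      AxiomsRenamed d
      × (∀ v → occD v d ≡ true → (occ v t ∨ occ v u) ≡ true ⊎ removals v d ≡ 1)

{-# OPTIONS --safe #-}
module Submission where

-- Erase to ε every variable not occurring in t = u. The resulting substitution θ sends variables to
-- atoms (ε or variables), so applying it preserves the size of every term. Now re-derive θ applied
-- to each equation of D by recursion on D, drawing fresh variables a, a + 1, … from a private range:
-- an Axiom instance σl = σr becomes an injective renaming of l = r followed by one Substitution per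
-- variable of l, each removing its own fresh variable; a Substitution binding x is redone on a fresh
-- variable (or dropped when x occurs in neither side). Every variable of the result then occurs in
-- t = u or is removed exactly once. Each rule keeps its cost, except an Axiom of cost c, which
-- becomes at most c + 1 rules of cost at most 2c, together at most 2c²; since n ↦ 2n² is
-- superadditive, the new derivation has length at most 2 lh(D)².

open import Defs
open import Data.Bool using (true; false; _∨_; if_then_else_; T)
open import Data.Bool.Properties using (¬-not)
open import Data.List using (List; []; _∷_; _++_; length)
open import Data.List.Properties using (length-++)
open import Data.List.Extrema.Nat using (max; xs≤max)
open import Data.List.Membership.Propositional using (_∈_)
open import Data.List.Membership.Propositional.Properties using (∈-++⁺ˡ; ∈-++⁺ʳ; ∈-++⁻)
open import Data.List.Relation.Unary.All using (All; []; _∷_; lookup; tabulate)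
open import Data.List.Relation.Unary.AllPairs using ([]; _∷_)
open import Data.List.Relation.Unary.Any using (here; there)
open import Data.List.Relation.Unary.Unique.Propositional using (Unique)
open import Data.Nat hiding (_/_)
open import Data.Nat.Properties
open import Data.Nat.Tactic.RingSolver using (solve-∀)
open import Data.Product using (Σ; _×_; _,_; proj₂)
open import Data.Sum using (_⊎_; inj₁; inj₂; [_,_]′)
open import Data.Unit using (tt)
open import Data.Vec using (Vec; []; _∷_)
open import Relation.Binary.PropositionalEquality hiding ([_])
open import Relation.Nullary using (¬_)

∨-true⁻ : ∀ {a b} → (a ∨ b) ≡ true → a ≡ true ⊎ b ≡ true
∨-true⁻ {true}  _ = inj₁ refl
∨-true⁻ {false} p = inj₂ p

∨-trueˡ : ∀ {a} b → a ≡ true → (a ∨ b) ≡ true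
∨-trueˡ b refl = refl

∨-trueʳ : ∀ a {b} → b ≡ true → (a ∨ b) ≡ true
∨-trueʳ true  _ = refl
∨-trueʳ false p = p

∨-true⁻₃ : ∀ {a b c} → (a ∨ b ∨ c) ≡ true → a ≡ true ⊎ b ≡ true ⊎ c ≡ true
∨-true⁻₃ {a} o with ∨-true⁻ {a} o
... | inj₁ p = inj₁ p
... | inj₂ q = inj₂ (∨-true⁻ q)

∨-false⁻ : ∀ {a b} → (a ∨ b) ≡ false → a ≡ false × b ≡ false
∨-false⁻ {false} p = refl , p

≡ᵇ-refl : ∀ n → (n ≡ᵇ n) ≡ true
≡ᵇ-refl zero    = refl
≡ᵇ-refl (suc n) = ≡ᵇ-refl n

≡ᵇ-true⇒≡ : ∀ {m n} → (m ≡ᵇ n) ≡ true → m ≡ n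
≡ᵇ-true⇒≡ {m} {n} p = ≡ᵇ⇒≡ m n (subst T (sym p) tt)

≡ᵇ-false⇒≢ : ∀ {m n} → (m ≡ᵇ n) ≡ false → m ≢ n
≡ᵇ-false⇒≢ {m} m≢ᵇm refl with () ← trans (sym m≢ᵇm) (≡ᵇ-refl m)

≢⇒≡ᵇ-false : ∀ {m n} → m ≢ n → (m ≡ᵇ n) ≡ false
≢⇒≡ᵇ-false m≢n = ¬-not (λ eq → m≢n (≡ᵇ-true⇒≡ eq))

module _ {S : Signature} where

  mutual
    sub-cong : ∀ {f g : ℕ → Term S} t → (∀ x → occ x t ≡ true → f x ≡ g x) → sub f t ≡ sub g t
    sub-cong (var x)    f≗g = f≗g x (≡ᵇ-refl x)
    sub-cong eps        f≗g = refl
    sub-cong (s0 t)     f≗g = cong s0 (sub-cong t f≗g)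
    sub-cong (s1 t)     f≗g = cong s1 (sub-cong t f≗g)
    sub-cong (app h ts) f≗g = cong (app h) (subs-cong ts f≗g)

    subs-cong : ∀ {n} {f g : ℕ → Term S} (ts : Vec (Term S) n) →
                (∀ x → occs x ts ≡ true → f x ≡ g x) → subs f ts ≡ subs g ts
    subs-cong []       f≗g = refl
    subs-cong (t ∷ ts) f≗g =
      cong₂ _∷_ (sub-cong t (λ x o → f≗g x (∨-trueˡ _ o)))
                (subs-cong ts (λ x o → f≗g x (∨-trueʳ (occ x t) o)))

  mutual
    sub-sub : ∀ (f g : ℕ → Term S) t → sub f (sub g t) ≡ sub (λ x → sub f (g x)) t
    sub-sub f g (var x)    = refl
    sub-sub f g eps        = refl
    sub-sub f g (s0 t)     = cong s0 (sub-sub f g t)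
    sub-sub f g (s1 t)     = cong s1 (sub-sub f g t)
    sub-sub f g (app h ts) = cong (app h) (subs-subs f g ts)

    subs-subs : ∀ {n} (f g : ℕ → Term S) (ts : Vec (Term S) n) →
                subs f (subs g ts) ≡ subs (λ x → sub f (g x)) ts
    subs-subs f g []       = refl
    subs-subs f g (t ∷ ts) = cong₂ _∷_ (sub-sub f g t) (subs-subs f g ts)

  mutual
    sub-var : ∀ t → sub var t ≡ t
    sub-var (var x)    = refl
    sub-var eps        = refl
    sub-var (s0 t)     = cong s0 (sub-var t)
    sub-var (s1 t)     = cong s1 (sub-var t)
    sub-var (app h ts) = cong (app h) (subs-var ts)

    subs-var : ∀ {n} (ts : Vec (Term S) n) → subs var ts ≡ ts
    subs-var []       = refl
    subs-var (t ∷ ts) = cong₂ _∷_ (sub-var t) (subs-var ts)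

  mutual
    occ-sub⁻ : ∀ v (f : ℕ → Term S) t → occ v (sub f t) ≡ true →
               Σ ℕ λ y → occ y t ≡ true × occ v (f y) ≡ true
    occ-sub⁻ v f (var x)    o = x , ≡ᵇ-refl x , o
    occ-sub⁻ v f (s0 t)     o = occ-sub⁻ v f t o
    occ-sub⁻ v f (s1 t)     o = occ-sub⁻ v f t o
    occ-sub⁻ v f (app h ts) o = occs-subs⁻ v f ts o

    occs-subs⁻ : ∀ {n} v (f : ℕ → Term S) (ts : Vec (Term S) n) → occs v (subs f ts) ≡ true →
                 Σ ℕ λ y → occs y ts ≡ true × occ v (f y) ≡ true
    occs-subs⁻ v f (t ∷ ts) o with ∨-true⁻ {occ v (sub f t)} o
    ... | inj₁ p = let y , oy , ov = occ-sub⁻ v f t p in y , ∨-trueˡ _ oy , ov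
    ... | inj₂ p = let y , oy , ov = occs-subs⁻ v f ts p in y , ∨-trueʳ (occ y t) oy , ov

  mutual
    occ-sub⁺ : ∀ v y (f : ℕ → Term S) t → occ y t ≡ true → occ v (f y) ≡ true → occ v (sub f t) ≡ true
    occ-sub⁺ v y f (var x)    oy ov rewrite ≡ᵇ-true⇒≡ {y} {x} oy = ov
    occ-sub⁺ v y f (s0 t)     oy ov = occ-sub⁺ v y f t oy ov
    occ-sub⁺ v y f (s1 t)     oy ov = occ-sub⁺ v y f t oy ov
    occ-sub⁺ v y f (app h ts) oy ov = occs-subs⁺ v y f ts oy ov

    occs-subs⁺ : ∀ {n} v y (f : ℕ → Term S) (ts : Vec (Term S) n) →
                 occs y ts ≡ true → occ v (f y) ≡ true → occs v (subs f ts) ≡ true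
    occs-subs⁺ v y f (t ∷ ts) oy ov with ∨-true⁻ {occ y t} oy
    ... | inj₁ p = ∨-trueˡ _ (occ-sub⁺ v y f t p ov)
    ... | inj₂ p = ∨-trueʳ (occ v (sub f t)) (occs-subs⁺ v y f ts p ov)

  mutual
    occ⇒∈vars : ∀ {x} t → occ x t ≡ true → x ∈ vars t
    occ⇒∈vars (var y)    o = here (≡ᵇ-true⇒≡ o)
    occ⇒∈vars (s0 t)     o = occ⇒∈vars t o
    occ⇒∈vars (s1 t)     o = occ⇒∈vars t o
    occ⇒∈vars (app f ts) o = occs⇒∈varss ts o

    occs⇒∈varss : ∀ {n x} (ts : Vec (Term S) n) → occs x ts ≡ true → x ∈ varss ts
    occs⇒∈varss (t ∷ ts) o with ∨-true⁻ {occ _ t} o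
    ... | inj₁ p = ∈-++⁺ˡ (occ⇒∈vars t p)
    ... | inj₂ p = ∈-++⁺ʳ (vars t) (occs⇒∈varss ts p)

  mutual
    ∈vars⇒occ : ∀ {x} t → x ∈ vars t → occ x t ≡ true
    ∈vars⇒occ {x} (var y) (here refl) = ≡ᵇ-refl x
    ∈vars⇒occ (s0 t)     x∈ = ∈vars⇒occ t x∈
    ∈vars⇒occ (s1 t)     x∈ = ∈vars⇒occ t x∈
    ∈vars⇒occ (app f ts) x∈ = ∈varss⇒occs ts x∈

    ∈varss⇒occs : ∀ {n x} (ts : Vec (Term S) n) → x ∈ varss ts → occs x ts ≡ true
    ∈varss⇒occs (t ∷ ts) x∈ with ∈-++⁻ (vars t) x∈
    ... | inj₁ p = ∨-trueˡ _ (∈vars⇒occ t p)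
    ... | inj₂ p = ∨-trueʳ (occ _ t) (∈varss⇒occs ts p)

  occ-≡ : ∀ {v} {t t′ : Term S} → t ≡ t′ → occ v t ≡ true → occ v t′ ≡ true
  occ-≡ {v} = subst (λ w → occ v w ≡ true)

  var-injective : ∀ {x y} → var {S} x ≡ var y → x ≡ y
  var-injective refl = refl

  [/]-unused : ∀ t s z → occ z t ≡ false → t [ s / z ] ≡ t
  [/]-unused t s z z∉t = trans (sub-cong t fixes) (sub-var t)
    where
    fixes : ∀ x → occ x t ≡ true → (if z ≡ᵇ x then s else var x) ≡ var x
    fixes x x∈t with z ≡ᵇ x in z≡x
    ... | false = refl
    ... | true with () ← trans (sym z∉t) (subst (λ w → occ w t ≡ true) (sym (≡ᵇ-true⇒≡ z≡x)) x∈t)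

  1≤size : ∀ (t : Term S) → 1 ≤ size t
  1≤size (var x)   = ≤-refl
  1≤size eps       = ≤-refl
  1≤size (s0 t)    = s≤s z≤n
  1≤size (s1 t)    = s≤s z≤n
  1≤size (app f _) = s≤s z≤n

  mutual
    size-sub-mono : ∀ {f g : ℕ → Term S} t → (∀ x → size (f x) ≤ size (g x)) →
                    size (sub f t) ≤ size (sub g t)
    size-sub-mono (var x)    f≤g = f≤g x
    size-sub-mono eps        f≤g = ≤-refl
    size-sub-mono (s0 t)     f≤g = s≤s (size-sub-mono t f≤g)
    size-sub-mono (s1 t)     f≤g = s≤s (size-sub-mono t f≤g)
    size-sub-mono (app h ts) f≤g = s≤s (sizes-subs-mono ts f≤g)

    sizes-subs-mono : ∀ {n} {f g : ℕ → Term S} (ts : Vec (Term S) n) →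
                      (∀ x → size (f x) ≤ size (g x)) → sizes (subs f ts) ≤ sizes (subs g ts)
    sizes-subs-mono []       f≤g = ≤-refl
    sizes-subs-mono (t ∷ ts) f≤g = +-mono-≤ (size-sub-mono t f≤g) (sizes-subs-mono ts f≤g)

  size≤size-sub : ∀ (f : ℕ → Term S) t → size t ≤ size (sub f t)
  size≤size-sub f t =
    subst (_≤ size (sub f t)) (cong size (sub-var t)) (size-sub-mono t (λ x → 1≤size (f x)))

  size-sub-atoms : ∀ {f : ℕ → Term S} t → (∀ x → size (f x) ≡ 1) → size (sub f t) ≡ size t
  size-sub-atoms {f} t f-atoms = ≤-antisym
    (subst (size (sub f t) ≤_) (cong size (sub-var t)) (size-sub-mono t (λ x → ≤-reflexive (f-atoms x))))
    (size≤size-sub f t)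

  mutual
    occ⇒size≤size-sub : ∀ y (f : ℕ → Term S) t → occ y t ≡ true → size (f y) ≤ size (sub f t)
    occ⇒size≤size-sub y f (var x) o rewrite ≡ᵇ-true⇒≡ {y} {x} o = ≤-refl
    occ⇒size≤size-sub y f (s0 t)     o = m≤n⇒m≤1+n (occ⇒size≤size-sub y f t o)
    occ⇒size≤size-sub y f (s1 t)     o = m≤n⇒m≤1+n (occ⇒size≤size-sub y f t o)
    occ⇒size≤size-sub y f (app h ts) o = m≤n⇒m≤1+n (occs⇒size≤sizes-subs y f ts o)

    occs⇒size≤sizes-subs : ∀ {n} y (f : ℕ → Term S) (ts : Vec (Term S) n) →
                           occs y ts ≡ true → size (f y) ≤ sizes (subs f ts)
    occs⇒size≤sizes-subs y f (t ∷ ts) o with ∨-true⁻ {occ y t} o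
    ... | inj₁ p = ≤-trans (occ⇒size≤size-sub y f t p) (m≤m+n _ _)
    ... | inj₂ p = ≤-trans (occs⇒size≤sizes-subs y f ts p) (m≤n+m _ _)

  mutual
    length-vars≤size : ∀ (t : Term S) → length (vars t) ≤ size t
    length-vars≤size (var x)    = ≤-refl
    length-vars≤size eps        = z≤n
    length-vars≤size (s0 t)     = m≤n⇒m≤1+n (length-vars≤size t)
    length-vars≤size (s1 t)     = m≤n⇒m≤1+n (length-vars≤size t)
    length-vars≤size (app f ts) = m≤n⇒m≤1+n (length-varss≤sizes ts)

    length-varss≤sizes : ∀ {n} (ts : Vec (Term S) n) → length (varss ts) ≤ sizes ts
    length-varss≤sizes []       = z≤n
    length-varss≤sizes (t ∷ ts) rewrite length-++ (vars t) {varss ts} =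
      +-mono-≤ (length-vars≤size t) (length-varss≤sizes ts)

  sub-[/]-unused : ∀ (θ : ℕ → Term S) t s {z} → occ z t ≡ false → sub θ t ≡ sub θ (t [ s / z ])
  sub-[/]-unused θ t s {z} z∉t = cong (sub θ) (sym ([/]-unused t s z z∉t))

  occurs? : ∀ x (t u : Term S) → (occ x t ∨ occ x u) ≡ true ⊎ (occ x t ≡ false × occ x u ≡ false)
  occurs? x t u with occ x t ∨ occ x u in x∈tu
  ... | true  = inj₁ refl
  ... | false = inj₂ (∨-false⁻ x∈tu)

freshFor : List ℕ → ℕ
freshFor xs = suc (max 0 xs)

∈⇒<freshFor : ∀ {x xs} → x ∈ xs → x < freshFor xs
∈⇒<freshFor {xs = xs} x∈xs = s≤s (lookup (xs≤max 0 xs) x∈xs)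

module _ {S : Signature} where

  record AtomicBelow (θ : ℕ → Term S) (a : ℕ) : Set where
    field atom : ∀ y → θ y ≡ eps ⊎ Σ ℕ λ v → θ y ≡ var v × v < a
  open AtomicBelow

  infix 30 _[_↦_]
  _[_↦_] : (ℕ → Term S) → ℕ → Term S → ℕ → Term S
  (θ [ x ↦ t ]) y = if x ≡ᵇ y then t else θ y

  occ-extend-self : ∀ (θ : ℕ → Term S) x a → occ a ((θ [ x ↦ var a ]) x) ≡ true
  occ-extend-self θ x a rewrite ≡ᵇ-refl x = ≡ᵇ-refl a

  extend-image : ∀ (θ : ℕ → Term S) x a y v → (θ [ x ↦ var a ]) y ≡ var v → v ≡ a ⊎ θ y ≡ var v
  extend-image θ x a y v θ′y≡v with x ≡ᵇ y
  ... | true  = inj₁ (sym (var-injective θ′y≡v))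
  ... | false = inj₂ θ′y≡v

  occ-sub-extend : ∀ (θ : ℕ → Term S) x a {t u} → (occ x t ∨ occ x u) ≡ true →
                   (occ a (sub (θ [ x ↦ var a ]) t) ∨ occ a (sub (θ [ x ↦ var a ]) u)) ≡ true
  occ-sub-extend θ x a {t} {u} x∈tu with ∨-true⁻ {occ x t} x∈tu
  ... | inj₁ x∈t = ∨-trueˡ _ (occ-sub⁺ a x (θ [ x ↦ var a ]) t x∈t (occ-extend-self θ x a))
  ... | inj₂ x∈u = ∨-trueʳ _ (occ-sub⁺ a x (θ [ x ↦ var a ]) u x∈u (occ-extend-self θ x a))

  module _ {θ : ℕ → Term S} {a : ℕ} (θ-atomic : AtomicBelow θ a) where

    size-sub-atomic : ∀ t → size (sub θ t) ≡ size t
    size-sub-atomic t = size-sub-atoms t atom-size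
      where
      atom-size : ∀ y → size (θ y) ≡ 1
      atom-size y with atom θ-atomic y
      ... | inj₁ θy≡ε           rewrite θy≡ε = refl
      ... | inj₂ (v , θy≡v , _) rewrite θy≡v = refl

    size-≡-sub : ∀ {t′} t → t′ ≡ sub θ t → size t′ ≡ size t
    size-≡-sub t t′≡θt = trans (cong size t′≡θt) (size-sub-atomic t)

    atomic-occ : ∀ v t → occ v (sub θ t) ≡ true → Σ ℕ λ y → θ y ≡ var v × v < a
    atomic-occ v t o with occ-sub⁻ v θ t o
    ... | y , _ , v∈θy with atom θ-atomic y
    ...   | inj₁ θy≡ε rewrite θy≡ε with () ← v∈θy
    ...   | inj₂ (w , θy≡w , w<a) rewrite θy≡w with refl ← ≡ᵇ-true⇒≡ {v} {w} v∈θy = y , θy≡w , w<a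

    atomic-unused : ∀ v t → a ≤ v → occ v (sub θ t) ≡ false
    atomic-unused v t a≤v = ¬-not (λ o → <⇒≱ (proj₂ (proj₂ (atomic-occ v t o))) a≤v)

    atomic-weaken : ∀ {b} → a ≤ b → AtomicBelow θ b
    atom (atomic-weaken a≤b) y with atom θ-atomic y
    ... | inj₁ θy≡ε           = inj₁ θy≡ε
    ... | inj₂ (v , θy≡v , v<a) = inj₂ (v , θy≡v , ≤-trans v<a a≤b)

    atomic-extend : ∀ x → AtomicBelow (θ [ x ↦ var a ]) (suc a)
    atom (atomic-extend x) y with x ≡ᵇ y
    ... | true  = inj₂ (a , refl , ≤-refl)
    ... | false = atom (atomic-weaken (n≤1+n a)) y

    sub-extend-[/] : ∀ x s t → (sub (θ [ x ↦ var a ]) t) [ sub θ s / a ] ≡ sub θ (t [ s / x ])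
    sub-extend-[/] x s t = begin
      (sub (θ [ x ↦ var a ]) t) [ sub θ s / a ]   ≡⟨ sub-sub _ _ t ⟩
      sub (λ y → (θ [ x ↦ var a ]) y [ sub θ s / a ]) t ≡⟨ sub-cong t (λ y _ → pointwise y) ⟩
      sub (λ y → sub θ (var y [ s / x ])) t       ≡⟨ sub-sub θ _ t ⟨
      sub θ (t [ s / x ])                         ∎
      where
      open ≡-Reasoning
      pointwise : ∀ y → (θ [ x ↦ var a ]) y [ sub θ s / a ] ≡ sub θ (var y [ s / x ])
      pointwise y with x ≡ᵇ y
      ... | true rewrite ≡ᵇ-refl a = refl
      ... | false with atom θ-atomic y
      ...   | inj₁ θy≡ε rewrite θy≡ε = refl
      ...   | inj₂ (v , θy≡v , v<a) rewrite θy≡v | ≢⇒≡ᵇ-false {a} {v} (λ a≡v → <⇒≢ v<a (sym a≡v)) = refl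

module _ {S : Signature} {Ax : Eqn {S} → Set} where

  cast : ∀ {t u t′ u′} → t ≡ t′ → u ≡ u′ → Ax ⊢ t ≈ u → Ax ⊢ t′ ≈ u′
  cast refl refl d = d

  cast-invariant : ∀ {ℓ} {A : Set ℓ} (P : ∀ {t u} → Ax ⊢ t ≈ u → A) {t u t′ u′}
                   (p : t ≡ t′) (q : u ≡ u′) (d : Ax ⊢ t ≈ u) → P (cast p q d) ≡ P d
  cast-invariant P refl refl d = refl

  cast-renamed : ∀ {t u t′ u′} (p : t ≡ t′) (q : u ≡ u′) (d : Ax ⊢ t ≈ u) →
                 AxiomsRenamed d → AxiomsRenamed (cast p q d)
  cast-renamed refl refl d renamed = renamed

  removals-substR-other : ∀ {t u} z s (d : Ax ⊢ t ≈ u) {v} → z ≢ v →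
                          removals v (substR z s d) ≡ removals v d
  removals-substR-other z s d z≢v rewrite ≢⇒≡ᵇ-false z≢v = refl

  removals-substR-self : ∀ {t u} z s (d : Ax ⊢ t ≈ u) → (occ z t ∨ occ z u) ≡ true → occ z s ≡ false →
                         removals z (substR z s d) ≡ suc (removals z d)
  removals-substR-self z s d z∈tu z∉s rewrite ≡ᵇ-refl z | z∈tu | z∉s = refl

-- Ranges of fresh variables and the quadratic bound

Outside : ℕ → ℕ → ℕ → Set
Outside a w v = v < a ⊎ a + w ≤ v

outside-+ˡ : ∀ {a w w′ v} → Outside a (w + w′) v → Outside a w v
outside-+ˡ              (inj₁ v<a)      = inj₁ v<a
outside-+ˡ {a} {w} {w′} (inj₂ a+w+w′≤v) = inj₂ (≤-trans (+-monoʳ-≤ a (m≤m+n w w′)) a+w+w′≤v)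

outside-+ʳ : ∀ {a w w′ v} → Outside a (w + w′) v → Outside (a + w) w′ v
outside-+ʳ {a} {w}          (inj₁ v<a)      = inj₁ (<-≤-trans v<a (m≤m+n a w))
outside-+ʳ {a} {w} {w′} {v} (inj₂ a+w+w′≤v) = inj₂ (subst (_≤ v) (sym (+-assoc a w w′)) a+w+w′≤v)

outside-suc : ∀ {a w v} → Outside a (suc w) v → Outside a w v
outside-suc         (inj₁ v<a)     = inj₁ v<a
outside-suc {a} {w} (inj₂ a+1+w≤v) = inj₂ (≤-trans (+-monoʳ-≤ a (n≤1+n w)) a+1+w≤v)

outside-shift : ∀ {a w v} → Outside a (suc w) v → Outside (suc a) w v
outside-shift             (inj₁ v<a)     = inj₁ (m<n⇒m<1+n v<a)
outside-shift {a} {w} {v} (inj₂ a+1+w≤v) = inj₂ (subst (_≤ v) (+-suc a w) a+1+w≤v)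

outside-≢ : ∀ {a w v} → Outside a (suc w) v → a ≢ v
outside-≢     (inj₁ v<a)     refl = <-irrefl refl v<a
outside-≢ {a} (inj₂ a+1+w≤v) refl = <-irrefl refl (<-≤-trans (m<m+n a z<s) a+1+w≤v)

twiceSquare : ℕ → ℕ
twiceSquare n = 2 * (n * n)

n≤twiceSquare : ∀ n → n ≤ twiceSquare n
n≤twiceSquare zero    = z≤n
n≤twiceSquare (suc n) = ≤-trans (m≤m*n (suc n) (suc n)) (m≤m+n _ _)

twiceSquare-mono : ∀ {m n} → m ≤ n → twiceSquare m ≤ twiceSquare n
twiceSquare-mono m≤n = *-monoʳ-≤ 2 (*-mono-≤ m≤n m≤n)

square-superadditive : ∀ m n → m * m + n * n ≤ (m + n) * (m + n)
square-superadditive m n = begin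
  m * m + n * n             ≤⟨ +-mono-≤ (*-monoʳ-≤ m (m≤m+n m n)) (*-monoʳ-≤ n (m≤n+m n m)) ⟩
  m * (m + n) + n * (m + n) ≡⟨ *-distribʳ-+ (m + n) m n ⟨
  (m + n) * (m + n)         ∎
  where open ≤-Reasoning

twiceSquare-superadditive : ∀ m n → twiceSquare m + twiceSquare n ≤ twiceSquare (m + n)
twiceSquare-superadditive m n = begin
  2 * (m * m) + 2 * (n * n) ≡⟨ *-distribˡ-+ 2 (m * m) (n * n) ⟨
  2 * (m * m + n * n)       ≤⟨ *-monoʳ-≤ 2 (square-superadditive m n) ⟩
  twiceSquare (m + n)       ∎
  where open ≤-Reasoning

twiceSquare-+ˡ : ∀ p {m m′} → m′ ≤ twiceSquare m → p + m′ ≤ twiceSquare (p + m)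
twiceSquare-+ˡ p {m} m′≤ = ≤-trans (+-mono-≤ (n≤twiceSquare p) m′≤) (twiceSquare-superadditive p m)

twiceSquare-+² : ∀ p {m m′ n n′} → m′ ≤ twiceSquare m → n′ ≤ twiceSquare n →
                 p + m′ + n′ ≤ twiceSquare (p + m + n)
twiceSquare-+² p {m} {n = n} m′≤ n′≤ =
  ≤-trans (+-mono-≤ (twiceSquare-+ˡ p m′≤) n′≤) (twiceSquare-superadditive (p + m) n)

linear-chain-bound : ∀ {k e} → k ≤ e → (k + 1) * (2 * e + 4) ≤ twiceSquare (e + 1 + 1)
linear-chain-bound {k} {e} k≤e = begin
  (k + 1) * (2 * e + 4)     ≤⟨ *-monoˡ-≤ (2 * e + 4) (+-monoˡ-≤ 1 (≤-trans k≤e (n≤1+n e))) ⟩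
  (suc e + 1) * (2 * e + 4) ≡⟨ expand e ⟩
  twiceSquare (e + 1 + 1)   ∎
  where
  open ≤-Reasoning
  expand : ∀ e → (suc e + 1) * (2 * e + 4) ≡ 2 * ((e + 1 + 1) * (e + 1 + 1))
  expand = solve-∀

rule-cost-≡ : ∀ {A A′ B B′ C C′} → A ≡ A′ → B ≡ B′ → C ≡ C′ →
              A + B + 1 + (1 + C + 1) ≡ A′ + B′ + 1 + (1 + C′ + 1)
rule-cost-≡ refl refl refl = refl

substitution-node-cost : ∀ {A B C E} → A + B ≤ E → C ≤ E → A + B + 1 + (1 + C + 1) ≤ 2 * E + 4
substitution-node-cost {A} {B} {C} {E} A+B≤E C≤E = begin
  A + B + 1 + (1 + C + 1) ≤⟨ +-mono-≤ (+-monoˡ-≤ 1 A+B≤E) (+-monoʳ-≤ 1 (+-monoˡ-≤ 1 C≤E)) ⟩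
  E + 1 + (1 + E + 1)     ≡⟨ collect E ⟩
  2 * E + 3               ≤⟨ +-monoʳ-≤ (2 * E) (n≤1+n 3) ⟩
  2 * E + 4               ∎
  where
  open ≤-Reasoning
  collect : ∀ e → e + 1 + (1 + e + 1) ≡ 2 * e + 3
  collect = solve-∀

-- Re-deriving an axiom instance through an injective renaming

module AxiomChain {S : Signature} {Ax : Eqn {S} → Set}
  (l r : Term S) (lr∈Ax : Ax (l , r))
  (r⊆l : ∀ x → occ x r ≡ true → occ x l ≡ true) (l-linear : Unique (vars l))
  (F : ℕ → Term S) (a : ℕ) (F-avoids : ∀ x y → occ (a + x) (F y) ≡ false) where

  -- The variables in ys are already instantiated by F; every other x is still renamed to a + x.
  stage : List ℕ → ℕ → Term S
  stage []       x = var (a + x)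
  stage (y ∷ ys) x = if y ≡ᵇ x then F x else stage ys x

  stage-cases : ∀ ys x → stage ys x ≡ F x ⊎ stage ys x ≡ var (a + x)
  stage-cases []       x = inj₂ refl
  stage-cases (y ∷ ys) x with y ≡ᵇ x
  ... | true  = inj₁ refl
  ... | false = stage-cases ys x

  stage-∈ : ∀ {x ys} → x ∈ ys → stage ys x ≡ F x
  stage-∈ {x} (here refl) rewrite ≡ᵇ-refl x = refl
  stage-∈ {x} {y ∷ ys} (there x∈ys) with y ≡ᵇ x
  ... | true  = refl
  ... | false = stage-∈ x∈ys

  stage-∉ : ∀ {x} ys → ¬ x ∈ ys → stage ys x ≡ var (a + x)
  stage-∉ []            x∉ys = refl
  stage-∉ {x} (y ∷ ys) x∉ys rewrite ≢⇒≡ᵇ-false {y} {x} (λ y≡x → x∉ys (here (sym y≡x))) =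
    stage-∉ ys (λ x∈ys → x∉ys (there x∈ys))

  stage-step : ∀ y ys x → (stage ys x) [ F y / a + y ] ≡ stage (y ∷ ys) x
  stage-step y ys x with y ≡ᵇ x in y≟x
  ... | true with refl ← ≡ᵇ-true⇒≡ {y} {x} y≟x with stage-cases ys y
  ...   | inj₁ eq rewrite eq = [/]-unused (F y) (F y) (a + y) (F-avoids y y)
  ...   | inj₂ eq rewrite eq | ≡ᵇ-refl (a + y) = refl
  stage-step y ys x | false with stage-cases ys x
  ...   | inj₁ eq rewrite eq = [/]-unused (F x) (F y) (a + y) (F-avoids y x)
  ...   | inj₂ eq rewrite eq | ≢⇒≡ᵇ-false {a + y} {a + x} (λ p → ≡ᵇ-false⇒≢ y≟x (+-cancelˡ-≡ a y x p)) =
    refl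

  sub-stage-step : ∀ y ys t → (sub (stage ys) t) [ F y / a + y ] ≡ sub (stage (y ∷ ys)) t
  sub-stage-step y ys t = trans (sub-sub _ _ t) (sub-cong t (λ x _ → stage-step y ys x))

  chain : ∀ ys → Ax ⊢ sub (stage ys) l ≈ sub (stage ys) r
  chain []       = axiom (l , r) lr∈Ax (stage [])
  chain (y ∷ ys) = cast (sub-stage-step y ys l) (sub-stage-step y ys r) (substR (a + y) (F y) (chain ys))

  chain-renamed : ∀ ys → AxiomsRenamed (chain ys)
  chain-renamed []       =
    (λ {x} _ → a + x , refl) , (λ {x} {y} _ _ eq → +-cancelˡ-≡ a x y (var-injective eq))
  chain-renamed (y ∷ ys) = cast-renamed (sub-stage-step y ys l) (sub-stage-step y ys r) _ (chain-renamed ys)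

  removals-chain-step : ∀ v y ys →
    removals v (chain (y ∷ ys)) ≡ removals v (substR (a + y) (F y) (chain ys))
  removals-chain-step v y ys =
    cast-invariant (removals v) (sub-stage-step y ys l) (sub-stage-step y ys r) (substR (a + y) (F y) (chain ys))

  chain-removals-below : ∀ {v} → v < a → ∀ ys → removals v (chain ys) ≡ 0
  chain-removals-below v<a []            = refl
  chain-removals-below {v} v<a (y ∷ ys) = begin
    removals v (chain (y ∷ ys))                   ≡⟨ removals-chain-step v y ys ⟩
    removals v (substR (a + y) (F y) (chain ys)) ≡⟨ removals-substR-other (a + y) (F y) (chain ys) a+y≢v ⟩
    removals v (chain ys)                         ≡⟨ chain-removals-below v<a ys ⟩
    0                                             ∎
    where
    open ≡-Reasoning
    a+y≢v : a + y ≢ v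
    a+y≢v a+y≡v = <⇒≱ v<a (subst (a ≤_) a+y≡v (m≤m+n a y))

  chain-removals-∉ : ∀ {x} ys → ¬ x ∈ ys → removals (a + x) (chain ys) ≡ 0
  chain-removals-∉ []            x∉ys = refl
  chain-removals-∉ {x} (y ∷ ys) x∉ys = begin
    removals (a + x) (chain (y ∷ ys))
      ≡⟨ removals-chain-step (a + x) y ys ⟩
    removals (a + x) (substR (a + y) (F y) (chain ys))
      ≡⟨ removals-substR-other (a + y) (F y) (chain ys) a+y≢a+x ⟩
    removals (a + x) (chain ys)
      ≡⟨ chain-removals-∉ ys (λ x∈ys → x∉ys (there x∈ys)) ⟩
    0 ∎
    where
    open ≡-Reasoning
    a+y≢a+x : a + y ≢ a + x
    a+y≢a+x eq = x∉ys (here (sym (+-cancelˡ-≡ a y x eq)))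

  chain-removals-∈ : ∀ {x} ys → Unique ys → All (λ y → occ y l ≡ true) ys → x ∈ ys →
                     removals (a + x) (chain ys) ≡ 1
  chain-removals-∈ {x} (y ∷ ys) (y∉ys ∷ _) (y∈l ∷ _) (here refl) = begin
    removals (a + x) (chain (x ∷ ys))
      ≡⟨ removals-chain-step (a + x) x ys ⟩
    removals (a + x) (substR (a + x) (F x) (chain ys))
      ≡⟨ removals-substR-self (a + x) (F x) (chain ys) a+x∈l (F-avoids x x) ⟩
    suc (removals (a + x) (chain ys))
      ≡⟨ cong suc (chain-removals-∉ ys x∉ys) ⟩
    1 ∎
    where
    open ≡-Reasoning
    x∉ys : ¬ x ∈ ys
    x∉ys x∈ys = lookup y∉ys x∈ys refl
    a+x∈l : (occ (a + x) (sub (stage ys) l) ∨ occ (a + x) (sub (stage ys) r)) ≡ true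
    a+x∈l = ∨-trueˡ _ (occ-sub⁺ (a + x) x (stage ys) l y∈l
                                 (occ-≡ (sym (stage-∉ ys x∉ys)) (≡ᵇ-refl (a + x))))
  chain-removals-∈ {x} (y ∷ ys) (y∉ys ∷ ys-unique) (_ ∷ ys⊆l) (there x∈ys) = begin
    removals (a + x) (chain (y ∷ ys))
      ≡⟨ removals-chain-step (a + x) y ys ⟩
    removals (a + x) (substR (a + y) (F y) (chain ys))
      ≡⟨ removals-substR-other (a + y) (F y) (chain ys) a+y≢a+x ⟩
    removals (a + x) (chain ys)
      ≡⟨ chain-removals-∈ ys ys-unique ys⊆l x∈ys ⟩
    1 ∎
    where
    open ≡-Reasoning
    a+y≢a+x : a + y ≢ a + x
    a+y≢a+x eq = lookup y∉ys x∈ys (+-cancelˡ-≡ a y x eq)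

  StageVariable : ℕ → Set
  StageVariable v = (Σ ℕ λ y → occ v (F y) ≡ true) ⊎ (Σ ℕ λ x → v ≡ a + x × occ x l ≡ true)

  occ-sub-stage : ∀ ys v t → (∀ x → occ x t ≡ true → occ x l ≡ true) →
                  occ v (sub (stage ys) t) ≡ true → StageVariable v
  occ-sub-stage ys v t t⊆l o with occ-sub⁻ v (stage ys) t o
  ... | y , y∈t , v∈stage with stage-cases ys y
  ...   | inj₁ eq = inj₁ (y , occ-≡ eq v∈stage)
  ...   | inj₂ eq = inj₂ (y , ≡ᵇ-true⇒≡ (occ-≡ eq v∈stage) , t⊆l y y∈t)

  chain-occD : ∀ ys v → occD v (chain ys) ≡ true → StageVariable v
  chain-occD [] v o with ∨-true⁻ {occ v (sub (stage []) l)} o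
  ... | inj₁ v∈l = occ-sub-stage [] v l (λ _ x∈l → x∈l) v∈l
  ... | inj₂ v∈r = occ-sub-stage [] v r r⊆l v∈r
  chain-occD (y ∷ ys) v o
    with ∨-true⁻ {occ v ((sub (stage ys) l) [ F y / a + y ])}
           (trans (sym (cast-invariant (occD v) (sub-stage-step y ys l) (sub-stage-step y ys r) _)) o)
  ... | inj₁ v∈l = occ-sub-stage (y ∷ ys) v l (λ _ x∈l → x∈l) (occ-≡ (sub-stage-step y ys l) v∈l)
  ... | inj₂ o′ with ∨-true⁻ {occ v ((sub (stage ys) r) [ F y / a + y ])} o′
  ...   | inj₁ v∈r = occ-sub-stage (y ∷ ys) v r r⊆l (occ-≡ (sub-stage-step y ys r) v∈r)
  ...   | inj₂ v∈chain = chain-occD ys v v∈chain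

  instanceSize : ℕ
  instanceSize = size (sub F l) + size (sub F r)

  size-sub-stage : ∀ ys t → size (sub (stage ys) t) ≤ size (sub F t)
  size-sub-stage ys t = size-sub-mono t stage≤F
    where
    stage≤F : ∀ x → size (stage ys x) ≤ size (F x)
    stage≤F x with stage-cases ys x
    ... | inj₁ eq rewrite eq = ≤-refl
    ... | inj₂ eq rewrite eq = 1≤size (F x)

  size-stage-endpoints : ∀ ys → size (sub (stage ys) l) + size (sub (stage ys) r) ≤ instanceSize
  size-stage-endpoints ys = +-mono-≤ (size-sub-stage ys l) (size-sub-stage ys r)

  chain-lh : ∀ ys → All (λ y → occ y l ≡ true) ys →
             lh (chain ys) ≤ (length ys + 1) * (2 * instanceSize + 4)
  chain-lh [] _ = begin
    size (sub (stage []) l) + size (sub (stage []) r) + 1 + 1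
      ≤⟨ +-monoˡ-≤ 1 (+-monoˡ-≤ 1 (size-stage-endpoints [])) ⟩
    instanceSize + 1 + 1
      ≤⟨ m≤m+n (instanceSize + 1 + 1) (instanceSize + 2) ⟩
    instanceSize + 1 + 1 + (instanceSize + 2)
      ≡⟨ collect instanceSize ⟩
    1 * (2 * instanceSize + 4) ∎
    where
    open ≤-Reasoning
    collect : ∀ e → e + 1 + 1 + (e + 2) ≡ 1 * (2 * e + 4)
    collect = solve-∀
  chain-lh (y ∷ ys) (y∈l ∷ ys⊆l)
    rewrite cast-invariant lh (sub-stage-step y ys l) (sub-stage-step y ys r) (substR (a + y) (F y) (chain ys))
          | sub-stage-step y ys l | sub-stage-step y ys r
    = +-mono-≤ (substitution-node-cost {size (sub (stage (y ∷ ys)) l)} (size-stage-endpoints (y ∷ ys))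
                                        (≤-trans (occ⇒size≤size-sub y F l y∈l) (m≤m+n _ _)))
               (chain-lh ys ys⊆l)

  vars-occur : All (λ y → occ y l ≡ true) (vars l)
  vars-occur = tabulate (∈vars⇒occ l)

  axiomChain : Ax ⊢ sub (stage (vars l)) l ≈ sub (stage (vars l)) r
  axiomChain = chain (vars l)

  sub-stage-vars : ∀ t → (∀ x → occ x t ≡ true → occ x l ≡ true) → sub (stage (vars l)) t ≡ sub F t
  sub-stage-vars t t⊆l = sub-cong t (λ x x∈t → stage-∈ (occ⇒∈vars l (t⊆l x x∈t)))

  axiomChain-removals-outside : ∀ {v} → Outside a (freshFor (vars l)) v → removals v axiomChain ≡ 0
  axiomChain-removals-outside (inj₁ v<a) = chain-removals-below v<a (vars l)
  axiomChain-removals-outside {v} (inj₂ a+fresh≤v) =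
    subst (λ w → removals w axiomChain ≡ 0) (m+[n∸m]≡n a≤v) (chain-removals-∉ (vars l) v∸a∉l)
    where
    a≤v : a ≤ v
    a≤v = ≤-trans (m≤m+n a _) a+fresh≤v
    v∸a∉l : ¬ (v ∸ a) ∈ vars l
    v∸a∉l v∸a∈l = <⇒≱ (∈⇒<freshFor v∸a∈l)
      (+-cancelˡ-≤ a _ _ (subst (a + freshFor (vars l) ≤_) (sym (m+[n∸m]≡n a≤v)) a+fresh≤v))

  axiomChain-occD : ∀ v → occD v axiomChain ≡ true →
    (Σ ℕ λ y → occ v (F y) ≡ true) ⊎ (a ≤ v × v < a + freshFor (vars l) × removals v axiomChain ≡ 1)
  axiomChain-occD v o with chain-occD (vars l) v o
  ... | inj₁ v∈F = inj₁ v∈F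
  ... | inj₂ (x , refl , x∈l) = inj₂ (m≤m+n a x , +-monoʳ-< a (∈⇒<freshFor x∈vars) ,
                                     chain-removals-∈ (vars l) l-linear vars-occur x∈vars)
    where
    x∈vars : x ∈ vars l
    x∈vars = occ⇒∈vars l x∈l

  axiomChain-lh : lh axiomChain ≤ twiceSquare (instanceSize + 1 + 1)
  axiomChain-lh = ≤-trans (chain-lh (vars l) vars-occur) (linear-chain-bound length-vars≤instanceSize)
    where
    length-vars≤instanceSize : length (vars l) ≤ instanceSize
    length-vars≤instanceSize = ≤-trans (length-vars≤size l) (≤-trans (size≤size-sub F l) (m≤m+n _ _))

-- Translating a derivation along an atomic substitution

module _ {S : Signature} where

  data Accounted (θ : ℕ → Term S) (a w v removed : ℕ) : Set where
    image : ∀ y → θ y ≡ var v → Accounted θ a w v removed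
    fresh : a ≤ v → v < a + w → removed ≡ 1 → Accounted θ a w v removed

  endpoint-accounted : ∀ {θ a} → AtomicBelow θ a → ∀ {w v removed} t →
                       occ v (sub θ t) ≡ true → Accounted θ a w v removed
  endpoint-accounted θ-atomic {v = v} t v∈θt =
    let y , θy≡v , _ = atomic-occ θ-atomic v t v∈θt in image y θy≡v

  accounted-endpoints : ∀ {θ a} → AtomicBelow θ a → ∀ {w v r} {P : Set} t u →
                        occ v (sub θ t) ≡ true ⊎ occ v (sub θ u) ≡ true ⊎ P →
                        (P → Accounted θ a w v r) → Accounted θ a w v r
  accounted-endpoints θ-atomic t u (inj₁ v∈t)        _      = endpoint-accounted θ-atomic t v∈t
  accounted-endpoints θ-atomic t u (inj₂ (inj₁ v∈u)) _      = endpoint-accounted θ-atomic u v∈u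
  accounted-endpoints θ-atomic t u (inj₂ (inj₂ p))   from-p = from-p p

  accounted-≡ : ∀ {θ a w v r r′} → r ≡ r′ → Accounted θ a w v r → Accounted θ a w v r′
  accounted-≡ r≡r′ (image y θy≡v)        = image y θy≡v
  accounted-≡ r≡r′ (fresh a≤v v<a+w once) = fresh a≤v v<a+w (trans (sym r≡r′) once)

  accounted-widen : ∀ {θ a w w′ v r} → w ≤ w′ → Accounted θ a w v r → Accounted θ a w′ v r
  accounted-widen w≤w′ (image y θy≡v)        = image y θy≡v
  accounted-widen {a = a} w≤w′ (fresh a≤v v<a+w once) =
    fresh a≤v (<-≤-trans v<a+w (+-monoʳ-≤ a w≤w′)) once

  accounted-+ˡ : ∀ {θ a w w′ v r₁ r₂} → (Outside (a + w) w′ v → r₂ ≡ 0) →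
                 Accounted θ a w v r₁ → Accounted θ a (w + w′) v (r₁ + r₂)
  accounted-+ˡ r₂-zero (image y θy≡v) = image y θy≡v
  accounted-+ˡ {a = a} {w} {w′} r₂-zero (fresh a≤v v<a+w once) =
    fresh a≤v (<-≤-trans v<a+w (+-monoʳ-≤ a (m≤m+n w w′))) (cong₂ _+_ once (r₂-zero (inj₁ v<a+w)))

  accounted-+ʳ : ∀ {θ a w w′ v r₁ r₂} → (Outside a w v → r₁ ≡ 0) →
                 Accounted θ (a + w) w′ v r₂ → Accounted θ a (w + w′) v (r₁ + r₂)
  accounted-+ʳ r₁-zero (image y θy≡v) = image y θy≡v
  accounted-+ʳ {a = a} {w} {w′} {v} r₁-zero (fresh a+w≤v v<a+w+w′ once) =
    fresh (≤-trans (m≤m+n a w) a+w≤v) (subst (v <_) (+-assoc a w w′) v<a+w+w′)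
          (cong₂ _+_ (r₁-zero (inj₂ a+w≤v)) once)

module _ {S : Signature} {Ax : Eqn {S} → Set} {θ : ℕ → Term S} {a : ℕ} (θ-atomic : AtomicBelow θ a) where

  module _ {t u : Term S} (s : Term S) (x : ℕ) (d : Ax ⊢ sub θ t ≈ sub θ u) where

    -- a only marks the hole of the context and occurs in no equation, so it need not be fresh for d.
    compat-atomic : Ax ⊢ sub θ (s [ t / x ]) ≈ sub θ (s [ u / x ])
    compat-atomic = cast (sub-extend-[/] θ-atomic x t s) (sub-extend-[/] θ-atomic x u s)
                         (compat (sub (θ [ x ↦ var a ]) s) a d)

    compat-atomic-invariant : ∀ {ℓ} {A : Set ℓ} (P : ∀ {t u} → Ax ⊢ t ≈ u → A) →
                              P compat-atomic ≡ P (compat (sub (θ [ x ↦ var a ]) s) a d)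
    compat-atomic-invariant P = cast-invariant P (sub-extend-[/] θ-atomic x t s) (sub-extend-[/] θ-atomic x u s) _

    compat-atomic-renamed : AxiomsRenamed d → AxiomsRenamed compat-atomic
    compat-atomic-renamed = cast-renamed (sub-extend-[/] θ-atomic x t s) (sub-extend-[/] θ-atomic x u s) _

    compat-atomic-occD : ∀ v → occD v compat-atomic ≡ true →
      occ v (sub θ (s [ t / x ])) ≡ true ⊎ occ v (sub θ (s [ u / x ])) ≡ true ⊎ occD v d ≡ true
    compat-atomic-occD v o with ∨-true⁻₃ {occ v ((sub (θ [ x ↦ var a ]) s) [ sub θ t / a ])}
                                         (trans (sym (compat-atomic-invariant (occD v))) o)
    ... | inj₁ v∈t        = inj₁ (occ-≡ (sub-extend-[/] θ-atomic x t s) v∈t)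
    ... | inj₂ (inj₁ v∈u) = inj₂ (inj₁ (occ-≡ (sub-extend-[/] θ-atomic x u s) v∈u))
    ... | inj₂ (inj₂ v∈d) = inj₂ (inj₂ v∈d)

    compat-atomic-lh : lh compat-atomic ≡ size (s [ t / x ]) + size (s [ u / x ]) + 1 + (1 + size s + 1) + lh d
    compat-atomic-lh = trans (compat-atomic-invariant lh) (cong (_+ lh d)
      (rule-cost-≡ (size-≡-sub θ-atomic (s [ t / x ]) (sub-extend-[/] θ-atomic x t s))
                   (size-≡-sub θ-atomic (s [ u / x ]) (sub-extend-[/] θ-atomic x u s))
                   (size-sub-atomic (atomic-extend θ-atomic x) s)))

  module _ {t u : Term S} (x : ℕ) (s : Term S)
           (d : Ax ⊢ sub (θ [ x ↦ var a ]) t ≈ sub (θ [ x ↦ var a ]) u) where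

    substR-atomic : Ax ⊢ sub θ (t [ s / x ]) ≈ sub θ (u [ s / x ])
    substR-atomic = cast (sub-extend-[/] θ-atomic x s t) (sub-extend-[/] θ-atomic x s u) (substR a (sub θ s) d)

    substR-atomic-invariant : ∀ {ℓ} {A : Set ℓ} (P : ∀ {t u} → Ax ⊢ t ≈ u → A) →
                              P substR-atomic ≡ P (substR a (sub θ s) d)
    substR-atomic-invariant P = cast-invariant P (sub-extend-[/] θ-atomic x s t) (sub-extend-[/] θ-atomic x s u) _

    substR-atomic-renamed : AxiomsRenamed d → AxiomsRenamed substR-atomic
    substR-atomic-renamed = cast-renamed (sub-extend-[/] θ-atomic x s t) (sub-extend-[/] θ-atomic x s u) _

    substR-atomic-removals : ∀ {v} → a ≢ v → removals v substR-atomic ≡ removals v d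
    substR-atomic-removals {v} a≢v =
      trans (substR-atomic-invariant (removals v)) (removals-substR-other a (sub θ s) d a≢v)

    substR-atomic-occD : ∀ v → occD v substR-atomic ≡ true →
      occ v (sub θ (t [ s / x ])) ≡ true ⊎ occ v (sub θ (u [ s / x ])) ≡ true ⊎ occD v d ≡ true
    substR-atomic-occD v o with ∨-true⁻₃ {occ v ((sub (θ [ x ↦ var a ]) t) [ sub θ s / a ])}
                                         (trans (sym (substR-atomic-invariant (occD v))) o)
    ... | inj₁ v∈t        = inj₁ (occ-≡ (sub-extend-[/] θ-atomic x s t) v∈t)
    ... | inj₂ (inj₁ v∈u) = inj₂ (inj₁ (occ-≡ (sub-extend-[/] θ-atomic x s u) v∈u))
    ... | inj₂ (inj₂ v∈d) = inj₂ (inj₂ v∈d)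

    substR-atomic-lh : lh substR-atomic ≡ size (t [ s / x ]) + size (u [ s / x ]) + 1 + (1 + size s + 1) + lh d
    substR-atomic-lh = trans (substR-atomic-invariant lh) (cong (_+ lh d)
      (rule-cost-≡ (size-≡-sub θ-atomic (t [ s / x ]) (sub-extend-[/] θ-atomic x s t))
                   (size-≡-sub θ-atomic (u [ s / x ]) (sub-extend-[/] θ-atomic x s u))
                   (size-sub-atomic θ-atomic s)))

    substR-atomic-accounted : ∀ {w v} → (occ x t ∨ occ x u) ≡ true → removals a d ≡ 0 →
                              Accounted (θ [ x ↦ var a ]) (suc a) w v (removals v d) →
                              Accounted θ a (suc w) v (removals v substR-atomic)
    substR-atomic-accounted {v = v} x∈tu d-quiet (image y θ′y≡v) with extend-image θ x a y v θ′y≡v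
    ... | inj₂ θy≡v = image y θy≡v
    ... | inj₁ refl = fresh ≤-refl (m<m+n a z<s) (begin
      removals a substR-atomic             ≡⟨ substR-atomic-invariant (removals a) ⟩
      removals a (substR a (sub θ s) d)    ≡⟨ removals-substR-self a (sub θ s) d (occ-sub-extend θ x a {t} {u} x∈tu)
                                                                     (atomic-unused θ-atomic a s ≤-refl) ⟩
      suc (removals a d)                   ≡⟨ cong suc d-quiet ⟩
      1                                    ∎)
      where open ≡-Reasoning
    substR-atomic-accounted {w} {v} _ _ (fresh a<v v<1+a+w once) =
      fresh (<⇒≤ a<v) (subst (v <_) (sym (+-suc a w)) v<1+a+w) (trans (substR-atomic-removals (<⇒≢ a<v)) once)

module _ {S : Signature} {Ax : Eqn {S} → Set} {θ : ℕ → Term S} (t u : Term S) (x : ℕ) (s : Term S)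
         (x∉t : occ x t ≡ false) (x∉u : occ x u ≡ false) (d : Ax ⊢ sub θ t ≈ sub θ u) where

  vacuous-substR : Ax ⊢ sub θ (t [ s / x ]) ≈ sub θ (u [ s / x ])
  vacuous-substR = cast (sub-[/]-unused θ t s x∉t) (sub-[/]-unused θ u s x∉u) d

  vacuous-substR-invariant : ∀ {ℓ} {A : Set ℓ} (P : ∀ {t u} → Ax ⊢ t ≈ u → A) → P vacuous-substR ≡ P d
  vacuous-substR-invariant P = cast-invariant P (sub-[/]-unused θ t s x∉t) (sub-[/]-unused θ u s x∉u) d

  vacuous-substR-renamed : AxiomsRenamed d → AxiomsRenamed vacuous-substR
  vacuous-substR-renamed = cast-renamed (sub-[/]-unused θ t s x∉t) (sub-[/]-unused θ u s x∉u) d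

module Translation {S : Signature} {Ax : Eqn {S} → Set} (nice : ∀ e → Ax e → NiceEqn e) where

  rhs⊆lhs : ∀ {l r} → Ax (l , r) → ∀ x → occ x r ≡ true → occ x l ≡ true
  rhs⊆lhs {l} {r} lr∈Ax x x∈r with nice (l , r) lr∈Ax
  ... | f , ts , refl , _ , _ , r⊆ts = ∈vars⇒occ (app f ts) (r⊆ts (occ⇒∈vars r x∈r))

  lhs-linear : ∀ {l r} → Ax (l , r) → Unique (vars l)
  lhs-linear {l} {r} lr∈Ax with nice (l , r) lr∈Ax
  ... | f , ts , refl , _ , ts-linear , _ = ts-linear

  module TranslatedAxiom {θ : ℕ → Term S} {a : ℕ} (θ-atomic : AtomicBelow θ a)
                         (l r : Term S) (lr∈Ax : Ax (l , r)) (σ : ℕ → Term S) where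
    open AxiomChain {Ax = Ax} l r lr∈Ax (rhs⊆lhs lr∈Ax) (lhs-linear lr∈Ax) (λ y → sub θ (σ y)) a
                    (λ x y → atomic-unused θ-atomic (a + x) (σ y) (m≤m+n a x)) public

    lhs-endpoint : sub (stage (vars l)) l ≡ sub θ (sub σ l)
    lhs-endpoint = trans (sub-stage-vars l (λ _ x∈l → x∈l)) (sym (sub-sub θ σ l))

    rhs-endpoint : sub (stage (vars l)) r ≡ sub θ (sub σ r)
    rhs-endpoint = trans (sub-stage-vars r (rhs⊆lhs lr∈Ax)) (sym (sub-sub θ σ r))

    derivation : Ax ⊢ sub θ (sub σ l) ≈ sub θ (sub σ r)
    derivation = cast lhs-endpoint rhs-endpoint axiomChain

    derivation-renamed : AxiomsRenamed derivation
    derivation-renamed = cast-renamed lhs-endpoint rhs-endpoint axiomChain (chain-renamed (vars l))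

    derivation-removals-outside : ∀ {v} → Outside a (freshFor (vars l)) v → removals v derivation ≡ 0
    derivation-removals-outside {v} out =
      trans (cast-invariant (removals v) lhs-endpoint rhs-endpoint axiomChain) (axiomChain-removals-outside out)

    derivation-lh : lh derivation ≤ twiceSquare (size (sub σ l) + size (sub σ r) + 1 + 1)
    derivation-lh = begin
      lh derivation                   ≡⟨ cast-invariant lh lhs-endpoint rhs-endpoint axiomChain ⟩
      lh axiomChain                   ≤⟨ axiomChain-lh ⟩
      twiceSquare (instanceSize + 1 + 1)
        ≡⟨ cong (λ e → twiceSquare (e + 1 + 1)) (cong₂ _+_ (size-θσ l) (size-θσ r)) ⟩
      twiceSquare (size (sub σ l) + size (sub σ r) + 1 + 1) ∎
      where
      open ≤-Reasoning
      size-θσ : ∀ t → size (sub (λ y → sub θ (σ y)) t) ≡ size (sub σ t)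
      size-θσ t = trans (cong size (sym (sub-sub θ σ t))) (size-sub-atomic θ-atomic (sub σ t))

    derivation-occD : ∀ v → occD v derivation ≡ true →
                      Accounted θ a (freshFor (vars l)) v (removals v derivation)
    derivation-occD v o
      with axiomChain-occD v (trans (sym (cast-invariant (occD v) lhs-endpoint rhs-endpoint axiomChain)) o)
    ... | inj₁ (y , v∈θσy)         = endpoint-accounted θ-atomic (σ y) v∈θσy
    ... | inj₂ (a≤v , v<a+w , once) =
      fresh a≤v v<a+w (trans (cast-invariant (removals v) lhs-endpoint rhs-endpoint axiomChain) once)

  -- translate, started at a, uses the fresh variables a, …, a + freshCount d - 1.
  freshCount : ∀ {t u} → Ax ⊢ t ≈ u → ℕ
  freshCount (axiom e _ _)  = freshFor (vars (lhsOf e))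
  freshCount (reflR _)      = 0
  freshCount (symR d)       = freshCount d
  freshCount (transR d d′)  = freshCount d + freshCount d′
  freshCount (compat _ _ d) = freshCount d
  freshCount (substR _ _ d) = suc (freshCount d)

  translate : ∀ {θ a} → AtomicBelow θ a → ∀ {t u} → Ax ⊢ t ≈ u → Ax ⊢ sub θ t ≈ sub θ u
  translate θ-atomic (axiom (l , r) lr∈Ax σ) = TranslatedAxiom.derivation θ-atomic l r lr∈Ax σ
  translate θ-atomic (reflR t)               = reflR _
  translate θ-atomic (symR d)                = symR (translate θ-atomic d)
  translate {a = a} θ-atomic (transR d d′)   =
    transR (translate θ-atomic d) (translate (atomic-weaken θ-atomic (m≤m+n a (freshCount d))) d′)
  translate θ-atomic (compat s x d)          = compat-atomic θ-atomic s x (translate θ-atomic d)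
  translate θ-atomic (substR {t} {u} x s d) with occurs? x t u
  ... | inj₁ _           = substR-atomic θ-atomic {t} {u} x s (translate (atomic-extend θ-atomic x) d)
  ... | inj₂ (x∉t , x∉u) = vacuous-substR t u x s x∉t x∉u (translate θ-atomic d)

  translate-renamed : ∀ {θ a} (θ-atomic : AtomicBelow θ a) {t u} (d : Ax ⊢ t ≈ u) →
                      AxiomsRenamed (translate θ-atomic d)
  translate-renamed θ-atomic (axiom (l , r) lr∈Ax σ) = TranslatedAxiom.derivation-renamed θ-atomic l r lr∈Ax σ
  translate-renamed θ-atomic (reflR t)               = tt
  translate-renamed θ-atomic (symR d)                = translate-renamed θ-atomic d
  translate-renamed {a = a} θ-atomic (transR d d′)   =
    translate-renamed θ-atomic d , translate-renamed (atomic-weaken θ-atomic (m≤m+n a (freshCount d))) d′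
  translate-renamed θ-atomic (compat s x d) =
    compat-atomic-renamed θ-atomic s x _ (translate-renamed θ-atomic d)
  translate-renamed θ-atomic (substR {t} {u} x s d) with occurs? x t u
  ... | inj₁ _           =
    substR-atomic-renamed θ-atomic {t} {u} x s _ (translate-renamed (atomic-extend θ-atomic x) d)
  ... | inj₂ (x∉t , x∉u) = vacuous-substR-renamed t u x s x∉t x∉u _ (translate-renamed θ-atomic d)

  translate-removals-outside : ∀ {θ a} (θ-atomic : AtomicBelow θ a) {t u} (d : Ax ⊢ t ≈ u) {v} →
                               Outside a (freshCount d) v → removals v (translate θ-atomic d) ≡ 0
  translate-removals-outside θ-atomic (axiom (l , r) lr∈Ax σ) =
    TranslatedAxiom.derivation-removals-outside θ-atomic l r lr∈Ax σ
  translate-removals-outside θ-atomic (reflR t) out = refl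
  translate-removals-outside θ-atomic (symR d)  out = translate-removals-outside θ-atomic d out
  translate-removals-outside {a = a} θ-atomic (transR d d′) out =
    cong₂ _+_ (translate-removals-outside θ-atomic d (outside-+ˡ out))
              (translate-removals-outside (atomic-weaken θ-atomic (m≤m+n a (freshCount d))) d′ (outside-+ʳ out))
  translate-removals-outside θ-atomic (compat s x d) {v} out =
    trans (compat-atomic-invariant θ-atomic s x _ (removals v)) (translate-removals-outside θ-atomic d out)
  translate-removals-outside θ-atomic (substR {t} {u} x s d) {v} out with occurs? x t u
  ... | inj₁ _           = trans (substR-atomic-removals θ-atomic {t} {u} x s _ (outside-≢ out))
                                 (translate-removals-outside (atomic-extend θ-atomic x) d (outside-shift out))
  ... | inj₂ (x∉t , x∉u) = trans (vacuous-substR-invariant t u x s x∉t x∉u _ (removals v))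
                                 (translate-removals-outside θ-atomic d (outside-suc out))

  translate-occD : ∀ {θ a} (θ-atomic : AtomicBelow θ a) {t u} (d : Ax ⊢ t ≈ u) {v} →
                   occD v (translate θ-atomic d) ≡ true →
                   Accounted θ a (freshCount d) v (removals v (translate θ-atomic d))
  translate-occD θ-atomic (axiom (l , r) lr∈Ax σ) {v} = TranslatedAxiom.derivation-occD θ-atomic l r lr∈Ax σ v
  translate-occD θ-atomic (reflR t) o =
    [ endpoint-accounted θ-atomic t , endpoint-accounted θ-atomic t ]′ (∨-true⁻ o)
  translate-occD {θ} θ-atomic (symR {t} {u} d) {v} o =
    accounted-endpoints θ-atomic u t (∨-true⁻₃ {occ v (sub θ u)} o) (translate-occD θ-atomic d)
  translate-occD {θ} {a} θ-atomic (transR {t} {_} {u} d d′) {v} o =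
    accounted-endpoints θ-atomic t u (∨-true⁻₃ {occ v (sub θ t)} o) λ v∈dd′ →
      [ (λ v∈d  → accounted-+ˡ (translate-removals-outside θ-atomic′ d′) (translate-occD θ-atomic d v∈d))
      , (λ v∈d′ → accounted-+ʳ (translate-removals-outside θ-atomic d) (translate-occD θ-atomic′ d′ v∈d′))
      ]′ (∨-true⁻ v∈dd′)
    where
    θ-atomic′ : AtomicBelow θ (a + freshCount d)
    θ-atomic′ = atomic-weaken θ-atomic (m≤m+n a (freshCount d))
  translate-occD θ-atomic (compat {t} {u} s x d) {v} o =
    accounted-endpoints θ-atomic (s [ t / x ]) (s [ u / x ]) (compat-atomic-occD θ-atomic s x _ v o) λ v∈d →
      accounted-≡ (sym (compat-atomic-invariant θ-atomic s x _ (removals v))) (translate-occD θ-atomic d v∈d)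
  translate-occD {θ} {a} θ-atomic (substR {t} {u} x s d) {v} o with occurs? x t u
  ... | inj₁ x∈tu =
    accounted-endpoints θ-atomic (t [ s / x ]) (u [ s / x ]) (substR-atomic-occD θ-atomic {t} {u} x s _ v o)
      λ v∈d → substR-atomic-accounted θ-atomic {t} {u} x s _ x∈tu
                (translate-removals-outside θ′-atomic d (inj₁ (n<1+n a))) (translate-occD θ′-atomic d v∈d)
    where
    θ′-atomic : AtomicBelow (θ [ x ↦ var a ]) (suc a)
    θ′-atomic = atomic-extend θ-atomic x
  ... | inj₂ (x∉t , x∉u) =
    accounted-≡ (sym (vacuous-substR-invariant t u x s x∉t x∉u _ (removals v)))
      (accounted-widen (n≤1+n _)
        (translate-occD θ-atomic d (trans (sym (vacuous-substR-invariant t u x s x∉t x∉u _ (occD v))) o)))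

  translate-lh : ∀ {θ a} (θ-atomic : AtomicBelow θ a) {t u} (d : Ax ⊢ t ≈ u) →
                 lh (translate θ-atomic d) ≤ twiceSquare (lh d)
  translate-lh θ-atomic (axiom (l , r) lr∈Ax σ) = TranslatedAxiom.derivation-lh θ-atomic l r lr∈Ax σ
  translate-lh θ-atomic (reflR t)
    rewrite size-sub-atomic θ-atomic t = n≤twiceSquare _
  translate-lh θ-atomic (symR {t} {u} d)
    rewrite size-sub-atomic θ-atomic t | size-sub-atomic θ-atomic u =
    twiceSquare-+ˡ (size u + size t + 1 + 1) (translate-lh θ-atomic d)
  translate-lh {a = a} θ-atomic (transR {t} {m} {u} d d′)
    rewrite size-sub-atomic θ-atomic t | size-sub-atomic θ-atomic u =
    twiceSquare-+² (size t + size u + 1 + 1)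
      (translate-lh θ-atomic d) (translate-lh (atomic-weaken θ-atomic (m≤m+n a (freshCount d))) d′)
  translate-lh θ-atomic (compat {t} {u} s x d) =
    ≤-trans (≤-reflexive (compat-atomic-lh θ-atomic s x (translate θ-atomic d)))
            (twiceSquare-+ˡ (size (s [ t / x ]) + size (s [ u / x ]) + 1 + (1 + size s + 1))
                            (translate-lh θ-atomic d))
  translate-lh θ-atomic (substR {t} {u} x s d) with occurs? x t u
  ... | inj₁ _           =
    ≤-trans (≤-reflexive (substR-atomic-lh θ-atomic {t} {u} x s (translate (atomic-extend θ-atomic x) d)))
            (twiceSquare-+ˡ (size (t [ s / x ]) + size (u [ s / x ]) + 1 + (1 + size s + 1))
                            (translate-lh (atomic-extend θ-atomic x) d))
  ... | inj₂ (x∉t , x∉u) =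
    ≤-trans (≤-reflexive (vacuous-substR-invariant t u x s x∉t x∉u (translate θ-atomic d) lh))
            (≤-trans (translate-lh θ-atomic d) (twiceSquare-mono {n = lh (substR x s d)} (m≤n+m (lh d) _)))

module _ {S : Signature} where

  eraseOthers : Term S → Term S → ℕ → Term S
  eraseOthers t u y = if occ y t ∨ occ y u then var y else eps

  eraseOthers-kept : ∀ t u {y} → (occ y t ∨ occ y u) ≡ true → eraseOthers t u y ≡ var y
  eraseOthers-kept t u y∈tu rewrite y∈tu = refl

  eraseOthers-image : ∀ t u y {v} → eraseOthers t u y ≡ var v → (occ v t ∨ occ v u) ≡ true
  eraseOthers-image t u y eq with occ y t ∨ occ y u in y∈tu
  eraseOthers-image t u y refl | true = y∈tu

  eraseOthers-atomic : ∀ t u → AtomicBelow (eraseOthers t u) (freshFor (vars t ++ vars u))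
  AtomicBelow.atom (eraseOthers-atomic t u) y with occ y t ∨ occ y u in y∈tu
  ... | false = inj₁ refl
  ... | true  = inj₂ (y , refl , ∈⇒<freshFor y∈vars)
    where
    y∈vars : y ∈ vars t ++ vars u
    y∈vars with ∨-true⁻ {occ y t} y∈tu
    ... | inj₁ y∈t = ∈-++⁺ˡ (occ⇒∈vars t y∈t)
    ... | inj₂ y∈u = ∈-++⁺ʳ (vars t) (occ⇒∈vars u y∈u)

  sub-eraseOthersˡ : ∀ t u → sub (eraseOthers t u) t ≡ t
  sub-eraseOthersˡ t u = trans (sub-cong t (λ y y∈t → eraseOthers-kept t u (∨-trueˡ _ y∈t))) (sub-var t)

  sub-eraseOthersʳ : ∀ t u → sub (eraseOthers t u) u ≡ u
  sub-eraseOthersʳ t u = trans (sub-cong u (λ y y∈u → eraseOthers-kept t u (∨-trueʳ (occ y t) y∈u))) (sub-var u)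

module Normalisation {S : Signature} {Ax : Eqn {S} → Set} (nice : ∀ e → Ax e → NiceEqn e)
                     {t u : Term S} (D : Ax ⊢ t ≈ u) where
  open Translation nice

  translated : Ax ⊢ sub (eraseOthers t u) t ≈ sub (eraseOthers t u) u
  translated = translate (eraseOthers-atomic t u) D

  normalForm : Ax ⊢ t ≈ u
  normalForm = cast (sub-eraseOthersˡ t u) (sub-eraseOthersʳ t u) translated

  normalForm-invariant : ∀ {ℓ} {A : Set ℓ} (P : ∀ {t u} → Ax ⊢ t ≈ u → A) → P normalForm ≡ P translated
  normalForm-invariant P = cast-invariant P (sub-eraseOthersˡ t u) (sub-eraseOthersʳ t u) translated

  normalForm-accounted : ∀ v → occD v normalForm ≡ true → (occ v t ∨ occ v u) ≡ true ⊎ removals v normalForm ≡ 1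
  normalForm-accounted v o
    with translate-occD (eraseOthers-atomic t u) D (trans (sym (normalForm-invariant (occD v))) o)
  ... | image y y↦v    = inj₁ (eraseOthers-image t u y y↦v)
  ... | fresh _ _ once = inj₂ (trans (normalForm-invariant (removals v)) once)

  normalForm-VNF : VNF normalForm
  normalForm-VNF =
    cast-renamed (sub-eraseOthersˡ t u) (sub-eraseOthersʳ t u) translated (translate-renamed _ D) ,
    normalForm-accounted

  normalForm-lh : lh normalForm ≤ twiceSquare (lh D)
  normalForm-lh = ≤-trans (≤-reflexive (normalForm-invariant lh)) (translate-lh (eraseOthers-atomic t u) D)

proposition3p17 : (S : Signature) (Ax : Eqn {S} → Set) → Nice Ax →
    Σ ℕ λ C → ∀ {t u : Term S} (D : Ax ⊢ t ≈ u) →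
      Σ (Ax ⊢ t ≈ u) λ D′ → VNF D′ × lh D′ ≤ C * (lh D * lh D)
proposition3p17 S Ax (nice , _) = 2 , λ D → normalForm D , normalForm-VNF D , normalForm-lh D
  where open Normalisation nice
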